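{- Let $n\ge1$ and let $Y_n$ be the set of partitions $\lambda=(\lambda_1\ge\lambda_2\ge\dots\ge\lambda_\ell>0)$ (including the empty partition) with $\lambda_1+\ell\le n$, i.e. Young diagrams whose smallest containing rectangle lies inside the staircase diagram $(n-1,n-2,\dots,1)$. Define Suter's map $\rho_n:Y_n\to Y_n$ as follows: drawing diagrams in French style (rows of boxes in the first quadrant, bottom row of length $k=\lambda_1$), discard the $k$ boxes of the bottom row, move all remaining boxes one step down and one step right, and insert a column of $n-1-k$ boxes at the left; equivalently $\rho_n(\lambda)=(\lambda_2+1,\dots,\lambda_\ell+1,1^{\,n-k-\ell})$. Give the box in row $i$ and column $j$ (both indexed from $1$ at the lower left) the weight $n+1-i-j$, and let $f(\lambda)$ be the sum of the weights of the boxes of $\lambda$. Then $f$ is $c$-mesic under the action of $\rho_n$ on $Y_n$, with $c=(n^3-n)/12$; i.e. the average of $f$ over every $\rho_n$-orbit equals $(n^3-n)/12$.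
   Context: $\rho_n$ is a bijection of $Y_n$ with $\rho_n^n=\mathrm{id}$, so all orbits are finite. $c$-mesic means the average of the statistic over every orbit equals $c$. -}

module Defs where

open import Data.Nat using (ℕ; zero; suc; _+_; _*_; _∸_; _≤_; _<_; _≥_)
open import Data.List using (List; []; _∷_; length; map; replicate; _++_)
open import Data.List.Relation.Unary.All using (All)
open import Data.List.Relation.Unary.Linked using (Linked)
open import Data.Product using (_×_)

IsPartition : List ℕ → Set
IsPartition λs = Linked _≥_ λs × All (λ x → 0 < x) λs

firstPart : List ℕ → ℕ
firstPart []      = 0
firstPart (k ∷ _) = k

InY : ℕ → List ℕ → Set
InY n λs = IsPartition λs × (firstPart λs + length λs ≤ n)

ρ : ℕ → List ℕ → List ℕ
ρ n []         = replicate (n ∸ 1) 1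
ρ n (k ∷ rest) = map suc rest ++ replicate (n ∸ k ∸ suc (length rest)) 1

iter : ℕ → (List ℕ → List ℕ) → List ℕ → List ℕ
iter zero    g x = x
iter (suc m) g x = g (iter m g x)

rowWeight : ℕ → ℕ → ℕ → ℕ
rowWeight n i zero    = 0
rowWeight n i (suc r) = rowWeight n i r + (n + 1 ∸ i ∸ suc r)

fFrom : ℕ → ℕ → List ℕ → ℕ
fFrom n i []       = 0
fFrom n i (r ∷ rs) = rowWeight n i r + fFrom n (suc i) rs

f : ℕ → List ℕ → ℕ
f n λs = fFrom n 1 λs

sumBelow : ℕ → (ℕ → ℕ) → ℕ
sumBelow zero    g = 0
sumBelow (suc m) g = sumBelow m g + g m

module Submission where

-- Under ρₙ every row moves one step down and one step right, so its boxes
-- keep their weights n + 1 − i − j until it becomes the bottom row and is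
-- discarded.  A row born (as a box of the new first column) at height r
-- therefore sweeps out, over its life, the staircase δᵣ = (r, r−1, …, 1);
-- write tri r for its weight.  Splitting each row's lifetime into the part
-- already lived and the part still to come gives two potentials on diagrams,
-- pastWeight and futureWeight, and two exchange identities (f-past, f-future)
-- showing that 2·f(λ) − tri λ₁ − tri ℓ(ρλ) is a coboundary.  On Yₙ we have
-- λ₁ + ℓ(ρλ) = n − 1, and complementary triangles add up: tri a + tri b =
-- tri (n − 1).  A coboundary sums to zero along a periodic orbit, so twice
-- the orbit sum of f is (period) · tri (n − 1), and 6 · tri (n − 1) = n³ − n.

open import Defs
open import Data.Nat using (ℕ; zero; suc; _+_; _*_; _∸_; _^_; _≤_; _<_; _≥_; z≤n; s≤s; z<s)
open import Data.Nat.Properties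
open import Data.List using (List; []; _∷_; length; map; replicate; _++_)
open import Data.List.Properties using (length-map; length-++; length-replicate)
open import Data.List.Relation.Unary.All using (All; universal)
open import Data.List.Relation.Unary.All.Properties using (++⁺; map⁺; replicate⁺)
open import Data.List.Relation.Unary.Linked using (Linked; []; [-]; _∷_)
import Data.List.Relation.Unary.Linked as Linked
open import Data.Product using (_,_)
open import Relation.Binary.PropositionalEquality using (_≡_; _≢_; refl; sym; trans; cong; cong₂; module ≡-Reasoning)
open import Data.Nat.Tactic.RingSolver using (solve-∀)
open import Algebra.Properties.CommutativeSemigroup +-commutativeSemigroup using (interchange)

open ≡-Reasoning

sumBelow-scale : ∀ k m (g : ℕ → ℕ) → sumBelow m (λ i → k * g i) ≡ k * sumBelow m g
sumBelow-scale k zero    g = sym (*-zeroʳ k)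
sumBelow-scale k (suc m) g =
  trans (cong (_+ k * g m) (sumBelow-scale k m g)) (sym (*-distribˡ-+ k _ (g m)))

sumBelow-const : ∀ m (g : ℕ → ℕ) c → (∀ i → g i ≡ c) → sumBelow m g ≡ m * c
sumBelow-const zero    g c eq = refl
sumBelow-const (suc m) g c eq =
  trans (cong₂ _+_ (sumBelow-const m g c eq) (eq m)) (+-comm (m * c) c)

-- If u − v is the coboundary (A − B) − (A − B) ∘ g, written without
-- subtraction, then the sums of u and v along any orbit segment differ by
-- boundary terms only.
coboundary-telescope : (g : List ℕ → List ℕ) (u v A B : List ℕ → ℕ) →
  (∀ x → u x + A (g x) + B x ≡ v x + A x + B (g x)) →
  ∀ a m → sumBelow m (λ i → u (iter i g a)) + A (iter m g a) + B a
        ≡ sumBelow m (λ i → v (iter i g a)) + A a + B (iter m g a)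
coboundary-telescope g u v A B step a zero    = refl
coboundary-telescope g u v A B step a (suc m) =
  +-cancelʳ-≡ (A x + B x) _ _ (begin
    U + u x + A (g x) + B a + (A x + B x)      ≡⟨ regroup U (u x) (A (g x)) (B a) (A x) (B x) ⟩
    (U + A x + B a) + (u x + A (g x) + B x)    ≡⟨ cong₂ _+_ (coboundary-telescope g u v A B step a m) (step x) ⟩
    (V + A a + B x) + (v x + A x + B (g x))    ≡⟨ regroup′ V (v x) (A a) (B (g x)) (A x) (B x) ⟩
    V + v x + A a + B (g x) + (A x + B x)      ∎)
  where
  x = iter m g a
  U = sumBelow m (λ i → u (iter i g a))
  V = sumBelow m (λ i → v (iter i g a))
  regroup : ∀ s t p q r w → s + t + p + q + (r + w) ≡ (s + r + q) + (t + p + w)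
  regroup = solve-∀
  regroup′ : ∀ s t p q r w → (s + p + w) + (t + r + q) ≡ s + t + p + q + (r + w)
  regroup′ = solve-∀

periodic-orbit-sum : (g : List ℕ → List ℕ) (u v A B : List ℕ → ℕ) →
  (∀ x → u x + A (g x) + B x ≡ v x + A x + B (g x)) →
  ∀ a m → iter m g a ≡ a →
  sumBelow m (λ i → u (iter i g a)) ≡ sumBelow m (λ i → v (iter i g a))
periodic-orbit-sum g u v A B step a m period =
  +-cancelʳ-≡ (A a + B a) _ _ (begin
    Σu + (A a + B a)                     ≡⟨ sym (+-assoc Σu (A a) (B a)) ⟩
    Σu + A a + B a                       ≡⟨ cong (λ y → Σu + A y + B a) (sym period) ⟩
    Σu + A (iter m g a) + B a            ≡⟨ coboundary-telescope g u v A B step a m ⟩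
    Σv + A a + B (iter m g a)            ≡⟨ cong (λ y → Σv + A a + B y) period ⟩
    Σv + A a + B a                       ≡⟨ +-assoc Σv (A a) (B a) ⟩
    Σv + (A a + B a)                     ∎)
  where
  Σu = sumBelow m (λ i → u (iter i g a))
  Σv = sumBelow m (λ i → v (iter i g a))

staircase : ℕ → ℕ → ℕ → ℕ
staircase n i zero    = 0
staircase n i (suc k) = rowWeight n i (suc k) + staircase n (suc i) k

tri : ℕ → ℕ → ℕ
tri n k = staircase n 1 k

triSum : ℕ → ℕ → ℕ
triSum n ℓ = sumBelow ℓ (tri n)

staircase-peel : ∀ n i k → staircase n i k ≡ rowWeight n i k + staircase n (suc i) (k ∸ 1)
staircase-peel n i zero    = refl
staircase-peel n i (suc k) = refl

box-weight : ∀ n i r → n + 1 ∸ i ∸ suc r ≡ n ∸ (i + r)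
box-weight n i r = begin
  n + 1 ∸ i ∸ suc r       ≡⟨ ∸-+-assoc (n + 1) i (suc r) ⟩
  n + 1 ∸ (i + suc r)     ≡⟨ cong₂ _∸_ (+-comm n 1) (+-suc i r) ⟩
  suc n ∸ suc (i + r)     ∎

-- Enlarging a staircase adds one antidiagonal of k + 1 boxes, all of the
-- same weight.
staircase-suc : ∀ n i k → staircase n i (suc k) ≡ staircase n i k + suc k * (n ∸ (i + k))
staircase-suc n i zero = cong (_+ 0) (box-weight n i 0)
staircase-suc n i (suc k) = begin
  (rowWeight n i (suc k) + (n + 1 ∸ i ∸ suc (suc k))) + staircase n (suc i) (suc k)
    ≡⟨ cong₂ _+_ (cong (rowWeight n i (suc k) +_) (box-weight n i (suc k))) next ⟩
  (rowWeight n i (suc k) + e) + (staircase n (suc i) k + suc k * e)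
    ≡⟨ interchange (rowWeight n i (suc k)) e (staircase n (suc i) k) (suc k * e) ⟩
  (rowWeight n i (suc k) + staircase n (suc i) k) + (e + suc k * e)
    ∎
  where
  e = n ∸ (i + suc k)
  next : staircase n (suc i) (suc k) ≡ staircase n (suc i) k + suc k * e
  next = trans (staircase-suc n (suc i) k)
               (cong (λ t → staircase n (suc i) k + suc k * (n ∸ t)) (sym (+-suc i k)))

tri-suc : ∀ n x → tri n (suc x) ≡ tri n x + suc x * (n ∸ suc x)
tri-suc n x = staircase-suc n 1 x

-- Complementary triangles: if a + b = n − 1 then δₐ and δ_b together weigh
-- as much as δₐ₊_b (the antidiagonals d and n − d have equal total weight).
tri-complement : ∀ n a b → suc (a + b) ≡ n → tri n a + tri n b ≡ tri n (a + b)
tri-complement n zero    b eq = refl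
tri-complement n (suc a) b eq = begin
  tri n (suc a) + tri n b                         ≡⟨ cong (_+ tri n b) (tri-suc n a) ⟩
  tri n a + suc a * (n ∸ suc a) + tri n b         ≡⟨ cong (λ t → tri n a + suc a * t + tri n b) n∸sa ⟩
  tri n a + suc a * suc b + tri n b               ≡⟨ swap (tri n a) (tri n b) (suc a) (suc b) ⟩
  tri n a + (tri n b + suc b * suc a)             ≡⟨ cong (λ t → tri n a + (tri n b + suc b * t)) (sym n∸sb) ⟩
  tri n a + (tri n b + suc b * (n ∸ suc b))       ≡⟨ cong (tri n a +_) (sym (tri-suc n b)) ⟩
  tri n a + tri n (suc b)                         ≡⟨ tri-complement n a (suc b) (trans (cong suc (+-suc a b)) eq) ⟩
  tri n (a + suc b)                               ≡⟨ cong (tri n) (+-suc a b) ⟩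
  tri n (suc a + b)                               ∎
  where
  split : suc a + suc b ≡ n
  split = trans (+-suc (suc a) b) eq
  n∸sa : n ∸ suc a ≡ suc b
  n∸sa = trans (cong (_∸ suc a) (sym split)) (m+n∸m≡n (suc a) (suc b))
  n∸sb : n ∸ suc b ≡ suc a
  n∸sb = trans (cong (_∸ suc b) (sym (trans (+-comm (suc b) (suc a)) split))) (m+n∸m≡n (suc b) (suc a))
  swap : ∀ s t c d → s + c * d + t ≡ s + (t + d * c)
  swap = solve-∀

tri-closed : ∀ n x → x ≤ n → 6 * tri n x + x * suc x * (x + suc x) ≡ 3 * n * (x * suc x)
tri-closed n zero    _  = sym (*-zeroʳ (3 * n))
tri-closed n (suc x) le = begin
  6 * tri n (suc x) + suc x * suc (suc x) * (suc x + suc (suc x))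
    ≡⟨ cong (λ t → 6 * t + suc x * suc (suc x) * (suc x + suc (suc x))) (tri-suc n x) ⟩
  6 * (tri n x + suc x * e) + suc x * suc (suc x) * (suc x + suc (suc x))
    ≡⟨ expand (tri n x) x e ⟩
  (6 * tri n x + x * suc x * (x + suc x)) + 3 * (suc x + e) * (suc x + suc x)
    ≡⟨ cong (_+ 3 * (suc x + e) * (suc x + suc x)) (tri-closed n x (≤-trans (n≤1+n x) le)) ⟩
  3 * n * (x * suc x) + 3 * (suc x + e) * (suc x + suc x)
    ≡⟨ cong (λ t → 3 * t * (x * suc x) + 3 * (suc x + e) * (suc x + suc x)) (sym n≡sx+e) ⟩
  3 * (suc x + e) * (x * suc x) + 3 * (suc x + e) * (suc x + suc x)
    ≡⟨ collect x e ⟩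
  3 * (suc x + e) * (suc x * suc (suc x))
    ≡⟨ cong (λ t → 3 * t * (suc x * suc (suc x))) n≡sx+e ⟩
  3 * n * (suc x * suc (suc x))
    ∎
  where
  e = n ∸ suc x
  n≡sx+e : suc x + e ≡ n
  n≡sx+e = m+[n∸m]≡n le
  expand : ∀ h x e → 6 * (h + suc x * e) + suc x * suc (suc x) * (suc x + suc (suc x))
                   ≡ (6 * h + x * suc x * (x + suc x)) + 3 * (suc x + e) * (suc x + suc x)
  expand = solve-∀
  collect : ∀ x e → 3 * (suc x + e) * (x * suc x) + 3 * (suc x + e) * (suc x + suc x)
                  ≡ 3 * (suc x + e) * (suc x * suc (suc x))
  collect = solve-∀

tri-full : ∀ p → 6 * tri (suc p) p ≡ suc p ^ 3 ∸ suc p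
tri-full p = sym (trans (cong (_∸ suc p) cube) (m+n∸n≡m (6 * T) (suc p)))
  where
  T = tri (suc p) p
  cube : suc p ^ 3 ≡ 6 * T + suc p
  cube = +-cancelʳ-≡ (p * suc p * (p + suc p)) _ _ (begin
    suc p ^ 3 + p * suc p * (p + suc p)               ≡⟨ expand p ⟩
    3 * suc p * (p * suc p) + suc p                   ≡⟨ cong (_+ suc p) (sym (tri-closed (suc p) p (n≤1+n p))) ⟩
    6 * T + p * suc p * (p + suc p) + suc p           ≡⟨ reorder (6 * T) p ⟩
    6 * T + suc p + p * suc p * (p + suc p)           ∎)
    where
    expand : ∀ p → suc p * (suc p * (suc p * 1)) + p * suc p * (p + suc p) ≡ 3 * suc p * (p * suc p) + suc p
    expand = solve-∀
    reorder : ∀ h p → h + p * suc p * (p + suc p) + suc p ≡ h + suc p + p * suc p * (p + suc p)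
    reorder = solve-∀

rowSum : (ℕ → ℕ → ℕ) → ℕ → List ℕ → ℕ
rowSum w i []       = 0
rowSum w i (r ∷ rs) = w i r + rowSum w (suc i) rs

rowSum-++ : ∀ w i xs ys → rowSum w i (xs ++ ys) ≡ rowSum w i xs + rowSum w (i + length xs) ys
rowSum-++ w i []       ys = cong (λ j → rowSum w j ys) (sym (+-identityʳ i))
rowSum-++ w i (x ∷ xs) ys = begin
  w i x + rowSum w (suc i) (xs ++ ys)
    ≡⟨ cong (w i x +_) (rowSum-++ w (suc i) xs ys) ⟩
  w i x + (rowSum w (suc i) xs + rowSum w (suc i + length xs) ys)
    ≡⟨ sym (+-assoc (w i x) _ _) ⟩
  w i x + rowSum w (suc i) xs + rowSum w (suc i + length xs) ys
    ≡⟨ cong (λ j → w i x + rowSum w (suc i) xs + rowSum w j ys) (sym (+-suc i (length xs))) ⟩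
  w i x + rowSum w (suc i) xs + rowSum w (i + suc (length xs)) ys
    ∎

-- The remaining life of a row at height i and length len: it will occupy
-- heights i, i−1, …, 1 with lengths len, len+1, …, len+i−1.
future : ℕ → ℕ → ℕ → ℕ
future n zero    len = 0
future n (suc i) len = rowWeight n (suc i) len + future n i (suc len)

-- A row born at height i (length 1) sweeps out the triangle δᵢ; in general
-- its future and the part of δᵢ₊ⱼ above it make up the whole triangle.
future-triangle : ∀ n i j → future n i (suc j) + staircase n (suc i) j ≡ tri n (i + j)
future-triangle n zero    j = refl
future-triangle n (suc i) j = begin
  rowWeight n (suc i) (suc j) + future n i (suc (suc j)) + staircase n (suc (suc i)) j
    ≡⟨ rotate (rowWeight n (suc i) (suc j)) (future n i (suc (suc j))) (staircase n (suc (suc i)) j) ⟩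
  future n i (suc (suc j)) + staircase n (suc i) (suc j)
    ≡⟨ future-triangle n i (suc j) ⟩
  tri n (i + suc j)
    ≡⟨ cong (tri n) (+-suc i j) ⟩
  tri n (suc i + j)
    ∎
  where
  rotate : ∀ a b c → a + b + c ≡ b + (a + c)
  rotate = solve-∀

-- The part of a row's life already lived (excluding now): it occupied the
-- heights above i with lengths len − 1, len − 2, …, 1.
pastFrom : ℕ → ℕ → List ℕ → ℕ
pastFrom n = rowSum (λ i len → staircase n (suc i) (len ∸ 1))

futureFrom : ℕ → ℕ → List ℕ → ℕ
futureFrom n = rowSum (future n)

pastWeight : ℕ → List ℕ → ℕ
pastWeight n λs = pastFrom n 1 λs

futureWeight : ℕ → List ℕ → ℕ
futureWeight n λs = futureFrom n 1 λs

-- Moving rows one step down-right: their current boxes become part of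
-- their past …
past-shift : ∀ n i rs → pastFrom n i (map suc rs) ≡ fFrom n (suc i) rs + pastFrom n (suc i) rs
past-shift n i []       = refl
past-shift n i (r ∷ rs) = begin
  staircase n (suc i) r + pastFrom n (suc i) (map suc rs)
    ≡⟨ cong₂ _+_ (staircase-peel n (suc i) r) (past-shift n (suc i) rs) ⟩
  (rowWeight n (suc i) r + staircase n (suc (suc i)) (r ∸ 1))
    + (fFrom n (suc (suc i)) rs + pastFrom n (suc (suc i)) rs)
    ≡⟨ interchange (rowWeight n (suc i) r) (staircase n (suc (suc i)) (r ∸ 1))
                   (fFrom n (suc (suc i)) rs) (pastFrom n (suc (suc i)) rs) ⟩
  (rowWeight n (suc i) r + fFrom n (suc (suc i)) rs)
    + (staircase n (suc (suc i)) (r ∸ 1) + pastFrom n (suc (suc i)) rs)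
    ∎

-- … and are removed from their future.
future-shift : ∀ n i rs → futureFrom n (suc i) rs ≡ fFrom n (suc i) rs + futureFrom n i (map suc rs)
future-shift n i []       = refl
future-shift n i (r ∷ rs) = begin
  (rowWeight n (suc i) r + future n i (suc r)) + futureFrom n (suc (suc i)) rs
    ≡⟨ cong ((rowWeight n (suc i) r + future n i (suc r)) +_) (future-shift n (suc i) rs) ⟩
  (rowWeight n (suc i) r + future n i (suc r))
    + (fFrom n (suc (suc i)) rs + futureFrom n (suc i) (map suc rs))
    ≡⟨ interchange (rowWeight n (suc i) r) (future n i (suc r))
                   (fFrom n (suc (suc i)) rs) (futureFrom n (suc i) (map suc rs)) ⟩
  (rowWeight n (suc i) r + fFrom n (suc (suc i)) rs)
    + (future n i (suc r) + futureFrom n (suc i) (map suc rs))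
    ∎

past-newborn : ∀ n i c → pastFrom n i (replicate c 1) ≡ 0
past-newborn n i zero    = refl
past-newborn n i (suc c) = past-newborn n (suc i) c

future-newborn : ∀ n i c → triSum n i + futureFrom n i (replicate c 1) ≡ triSum n (i + c)
future-newborn n i zero    = trans (+-identityʳ (triSum n i)) (cong (triSum n) (sym (+-identityʳ i)))
future-newborn n i (suc c) = begin
  triSum n i + (future n i 1 + futureFrom n (suc i) (replicate c 1))
    ≡⟨ cong (λ t → triSum n i + (t + futureFrom n (suc i) (replicate c 1))) newborn ⟩
  triSum n i + (tri n i + futureFrom n (suc i) (replicate c 1))
    ≡⟨ sym (+-assoc (triSum n i) (tri n i) _) ⟩
  triSum n (suc i) + futureFrom n (suc i) (replicate c 1)
    ≡⟨ future-newborn n (suc i) c ⟩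
  triSum n (suc i + c)
    ≡⟨ cong (triSum n) (sym (+-suc i c)) ⟩
  triSum n (i + suc c)
    ∎
  where
  newborn : future n i 1 ≡ tri n i
  newborn = trans (sym (+-identityʳ (future n i 1)))
                  (trans (future-triangle n i 0) (cong (tri n) (+-identityʳ i)))

length-shift-pad : ∀ rs c → length (map suc rs ++ replicate c 1) ≡ length rs + c
length-shift-pad rs c =
  trans (length-++ (map suc rs)) (cong₂ _+_ (length-map suc rs) (length-replicate c))

-- The first row dies, contributing the last slice of its lifetime triangle.
f-past : ∀ n λs → f n λs + pastWeight n λs ≡ tri n (firstPart λs) + pastWeight n (ρ n λs)
f-past n []         = sym (past-newborn n 1 (n ∸ 1))
f-past n (k ∷ rest) = begin
  (rowWeight n 1 k + fFrom n 2 rest) + (staircase n 2 (k ∸ 1) + pastFrom n 2 rest)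
    ≡⟨ interchange (rowWeight n 1 k) (fFrom n 2 rest) (staircase n 2 (k ∸ 1)) (pastFrom n 2 rest) ⟩
  (rowWeight n 1 k + staircase n 2 (k ∸ 1)) + (fFrom n 2 rest + pastFrom n 2 rest)
    ≡⟨ cong₂ _+_ (sym (staircase-peel n 1 k)) (sym (past-shift n 1 rest)) ⟩
  tri n k + pastFrom n 1 (map suc rest)
    ≡⟨ cong (tri n k +_) (sym (+-identityʳ _)) ⟩
  tri n k + (pastFrom n 1 (map suc rest) + 0)
    ≡⟨ cong (λ t → tri n k + (pastFrom n 1 (map suc rest) + t)) (sym (past-newborn n _ c)) ⟩
  tri n k + (pastFrom n 1 (map suc rest) + pastFrom n (1 + length (map suc rest)) (replicate c 1))
    ≡⟨ cong (tri n k +_) (sym (rowSum-++ _ 1 (map suc rest) (replicate c 1))) ⟩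
  tri n k + pastWeight n (ρ n (k ∷ rest))
    ∎
  where
  c = n ∸ k ∸ suc (length rest)

-- The newborn rows of ρ λ bring their whole lifetime triangles.
f-future : ∀ n λs →
  f n λs + futureWeight n (ρ n λs) + triSum n (length λs)
    ≡ futureWeight n λs + triSum n (suc (length (ρ n λs)))
f-future n [] = begin
  futureFrom n 1 (replicate (n ∸ 1) 1) + 0    ≡⟨ +-identityʳ _ ⟩
  futureFrom n 1 (replicate (n ∸ 1) 1)        ≡⟨ future-newborn n 1 (n ∸ 1) ⟩
  triSum n (suc (n ∸ 1))                      ≡⟨ cong (λ t → triSum n (suc t)) (sym (length-replicate (n ∸ 1))) ⟩
  triSum n (suc (length (replicate (n ∸ 1) 1))) ∎
f-future n (k ∷ rest) = begin
  (rowWeight n 1 k + fFrom n 2 rest) + futureFrom n 1 (map suc rest ++ ones) + triSum n (suc L)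
    ≡⟨ cong (λ t → (rowWeight n 1 k + fFrom n 2 rest) + t + triSum n (suc L))
            (rowSum-++ (future n) 1 (map suc rest) ones) ⟩
  (rowWeight n 1 k + fFrom n 2 rest)
    + (futureFrom n 1 (map suc rest) + futureFrom n (suc (length (map suc rest))) ones) + triSum n (suc L)
    ≡⟨ cong (λ l → (rowWeight n 1 k + fFrom n 2 rest)
                    + (futureFrom n 1 (map suc rest) + futureFrom n (suc l) ones) + triSum n (suc L))
            (length-map suc rest) ⟩
  (rowWeight n 1 k + fFrom n 2 rest)
    + (futureFrom n 1 (map suc rest) + futureFrom n (suc L) ones) + triSum n (suc L)
    ≡⟨ regroup (rowWeight n 1 k) (fFrom n 2 rest) (futureFrom n 1 (map suc rest))
               (futureFrom n (suc L) ones) (triSum n (suc L)) ⟩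
  rowWeight n 1 k + (fFrom n 2 rest + futureFrom n 1 (map suc rest))
    + (triSum n (suc L) + futureFrom n (suc L) ones)
    ≡⟨ cong₂ (λ s t → rowWeight n 1 k + s + t) (sym (future-shift n 1 rest)) (future-newborn n (suc L) c) ⟩
  rowWeight n 1 k + futureFrom n 2 rest + triSum n (suc L + c)
    ≡⟨ cong₂ (λ s t → s + futureFrom n 2 rest + triSum n (suc t))
             (sym (+-identityʳ (rowWeight n 1 k))) (sym (length-shift-pad rest c)) ⟩
  future n 1 k + futureFrom n 2 rest + triSum n (suc (length (map suc rest ++ ones)))
    ≡⟨⟩
  futureWeight n (k ∷ rest) + triSum n (suc (length (ρ n (k ∷ rest))))
    ∎
  where
  L = length rest
  c = n ∸ k ∸ suc L
  ones = replicate c 1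
  regroup : ∀ a b x y t → (a + b) + (x + y) + t ≡ a + (b + x) + (t + y)
  regroup = solve-∀

-- The lifetime triangles of the dying bottom row of λ and of the column
-- inserted by ρ.
complementaryTris : ℕ → List ℕ → ℕ
complementaryTris n λs = tri n (firstPart λs) + tri n (length (ρ n λs))

-- Sum of f-past and f-future: 2f − complementaryTris is the coboundary of
-- futureWeight − (pastWeight + triSum ∘ length).
ρ-exchange : ∀ n λs →
  2 * f n λs + futureWeight n (ρ n λs) + (pastWeight n λs + triSum n (length λs))
    ≡ complementaryTris n λs + futureWeight n λs + (pastWeight n (ρ n λs) + triSum n (length (ρ n λs)))
ρ-exchange n λs = begin
  2 * fλ + Fρ + (Pλ + Sλ)                   ≡⟨ split fλ Fρ Pλ Sλ ⟩
  (fλ + Pλ) + (fλ + Fρ + Sλ)                ≡⟨ cong₂ _+_ (f-past n λs) (f-future n λs) ⟩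
  (tk + Pρ) + (Fλ + (Sρ + tρ))              ≡⟨ merge tk Pρ Fλ Sρ tρ ⟩
  (tk + tρ) + Fλ + (Pρ + Sρ)                ∎
  where
  fλ = f n λs
  Fρ = futureWeight n (ρ n λs)
  Fλ = futureWeight n λs
  Pλ = pastWeight n λs
  Pρ = pastWeight n (ρ n λs)
  Sλ = triSum n (length λs)
  Sρ = triSum n (length (ρ n λs))
  tk = tri n (firstPart λs)
  tρ = tri n (length (ρ n λs))
  split : ∀ a b c d → 2 * a + b + (c + d) ≡ (a + c) + (a + b + d)
  split = solve-∀
  merge : ∀ a b c d e → (a + b) + (c + (d + e)) ≡ (a + e) + c + (b + d)
  merge = solve-∀

linked-shift-pad : ∀ c rs → Linked _≥_ rs → Linked _≥_ (map suc rs ++ replicate c 1)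
linked-shift-pad c             []            _          = ones c
  where
  ones : ∀ c → Linked _≥_ (replicate c 1)
  ones zero          = []
  ones (suc zero)    = [-]
  ones (suc (suc c)) = s≤s z≤n ∷ ones (suc c)
linked-shift-pad zero          (r ∷ [])      _          = [-]
linked-shift-pad (suc c)       (r ∷ [])      _          = s≤s z≤n ∷ linked-shift-pad (suc c) [] []
linked-shift-pad c             (r ∷ r′ ∷ rs) (r≥r′ ∷ l) = s≤s r≥r′ ∷ linked-shift-pad c (r′ ∷ rs) l

positive-shift-pad : ∀ c rs → All (λ x → 0 < x) (map suc rs ++ replicate c 1)
positive-shift-pad c rs = ++⁺ (map⁺ (universal (λ _ → z<s) rs)) (replicate⁺ c z<s)

firstPart-ones : ∀ c → firstPart (replicate c 1) ≤ 1
firstPart-ones zero    = z≤n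
firstPart-ones (suc c) = ≤-refl

firstPart-ρ : ∀ n λs → Linked _≥_ λs → firstPart (ρ n λs) ≤ suc (firstPart λs)
firstPart-ρ n []             _ = firstPart-ones (n ∸ 1)
firstPart-ρ n (k ∷ [])       _ = ≤-trans (firstPart-ones (n ∸ k ∸ 1)) (s≤s z≤n)
firstPart-ρ n (k ∷ r ∷ rest) l = s≤s (Linked.head l)

ρ-length : ∀ p λs → firstPart λs + length λs ≤ suc p → firstPart λs + length (ρ (suc p) λs) ≡ p
ρ-length p []         _  = length-replicate p
ρ-length p (k ∷ rest) le = suc-injective (begin
  suc (k + length (map suc rest ++ replicate c 1))  ≡⟨ cong (λ t → suc (k + t)) (length-shift-pad rest c) ⟩
  suc (k + (L + c))                                 ≡⟨ reassoc k L c ⟩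
  k + suc L + c                                     ≡⟨ cong (k + suc L +_) (∸-+-assoc (suc p) k (suc L)) ⟩
  k + suc L + (suc p ∸ (k + suc L))                 ≡⟨ m+[n∸m]≡n le ⟩
  suc p                                             ∎)
  where
  L = length rest
  c = suc p ∸ k ∸ suc L
  reassoc : ∀ k L c → suc (k + (L + c)) ≡ k + suc L + c
  reassoc = solve-∀

ρ-Y : ∀ p λs → InY (suc p) λs → InY (suc p) (ρ (suc p) λs)
ρ-Y p λs ((decreasing , _) , bound) = (linked-ρ λs decreasing , positive-ρ λs) , bound-ρ
  where
  linked-ρ : ∀ λs → Linked _≥_ λs → Linked _≥_ (ρ (suc p) λs)
  linked-ρ []         _ = linked-shift-pad p [] []
  linked-ρ (k ∷ rest) l = linked-shift-pad _ rest (Linked.tail l)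
  positive-ρ : ∀ λs → All (λ x → 0 < x) (ρ (suc p) λs)
  positive-ρ []         = positive-shift-pad p []
  positive-ρ (k ∷ rest) = positive-shift-pad _ rest
  bound-ρ : firstPart (ρ (suc p) λs) + length (ρ (suc p) λs) ≤ suc p
  bound-ρ = ≤-trans (+-monoˡ-≤ _ (firstPart-ρ (suc p) λs decreasing))
                    (≤-reflexive (cong suc (ρ-length p λs bound)))

iter-Y : ∀ p λs → InY (suc p) λs → ∀ i → InY (suc p) (iter i (ρ (suc p)) λs)
iter-Y p λs y zero    = y
iter-Y p λs y (suc i) = ρ-Y p _ (iter-Y p λs y i)

complementaryTris-Y : ∀ p λs → InY (suc p) λs → complementaryTris (suc p) λs ≡ tri (suc p) p
complementaryTris-Y p λs (_ , bound) =
  trans (tri-complement (suc p) (firstPart λs) (length (ρ (suc p) λs)) (cong suc fill))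
        (cong (tri (suc p)) fill)
  where
  fill : firstPart λs + length (ρ (suc p) λs) ≡ p
  fill = ρ-length p λs bound

twice-orbit-sum : ∀ p λs → InY (suc p) λs → ∀ m → iter m (ρ (suc p)) λs ≡ λs →
  2 * sumBelow m (λ i → f (suc p) (iter i (ρ (suc p)) λs)) ≡ m * tri (suc p) p
twice-orbit-sum p λs y m period = begin
  2 * sumBelow m (λ i → f n (iter i (ρ n) λs))
    ≡⟨ sym (sumBelow-scale 2 m _) ⟩
  sumBelow m (λ i → 2 * f n (iter i (ρ n) λs))
    ≡⟨ periodic-orbit-sum (ρ n) (λ x → 2 * f n x) (complementaryTris n) (futureWeight n)
                          (λ x → pastWeight n x + triSum n (length x)) (ρ-exchange n) λs m period ⟩
  sumBelow m (λ i → complementaryTris n (iter i (ρ n) λs))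
    ≡⟨ sumBelow-const m _ _ (λ i → complementaryTris-Y p _ (iter-Y p λs y i)) ⟩
  m * tri n p
    ∎
  where
  n = suc p

proposition9 : (n : ℕ) → 1 ≤ n → (λs : List ℕ) → InY n λs →
    (m : ℕ) → 1 ≤ m → iter m (ρ n) λs ≡ λs →
    (∀ k → 1 ≤ k → k < m → iter k (ρ n) λs ≢ λs) →
    12 * sumBelow m (λ i → f n (iter i (ρ n) λs)) ≡ m * (n ^ 3 ∸ n)
proposition9 (suc p) _ λs y m _ period _ = begin
  12 * orbitSum          ≡⟨ *-assoc 6 2 orbitSum ⟩
  6 * (2 * orbitSum)     ≡⟨ cong (6 *_) (twice-orbit-sum p λs y m period) ⟩
  6 * (m * tri n p)      ≡⟨ reorder m (tri n p) ⟩
  m * (6 * tri n p)      ≡⟨ cong (m *_) (tri-full p) ⟩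
  m * (n ^ 3 ∸ n)        ∎
  where
  n = suc p
  orbitSum = sumBelow m (λ i → f n (iter i (ρ n) λs))
  reorder : ∀ m t → 6 * (m * t) ≡ m * (6 * t)
  reorder = solve-∀
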